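{- Let $k\in\mathbb{N}$ and $G\in\mathcal{L}^k$. Then the clique-width of $G$ satisfies $\mathrm{cwd}(G)\le 2^k+1$.
   Context: Two distinct letters $\mathtt a,\mathtt b$ alternate in a word $w$ if deleting all other letters yields one of $(\mathtt{ab})^n$, $(\mathtt{ab})^n\mathtt a$, $(\mathtt{ba})^n$, $(\mathtt{ba})^n\mathtt b$ for some $n\ge1$. A graph $G=(V,E)$ is represented by $w$ if the set of letters of $w$ is $V$ and distinct $\mathtt a,\mathtt b\in V$ alternate in $w$ iff $\{\mathtt a,\mathtt b\}\in E$. A marking sequence for $w$ is an enumeration $(\mathtt a_1,\dots,\mathtt a_n)$ of the distinct letters of $w$; at stage $i$ all occurrences of $\mathtt a_1,\dots,\mathtt a_i$ are marked, and a marked block is a maximal factor of consecutive marked positions; $w$ is $k$-local if some marking sequence gives at most $k$ marked blocks at every stage. $\mathcal L^k$ is the class of graphs represented by some $k$-local word. Clique-width: using the operations "create a node $v$ with label $\ell$", disjoint union, "add all edges between label-$\ell$ and label-$\ell'$ nodes ($\ell\neq\ell'$)", and "rename label $\ell$ to $\ell'$", $\mathrm{cwd}(G)$ is the minimum number of distinct labels needed in an expression producing a labelled version of $G$. -}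

module Defs where

open import Data.Nat using (ℕ; zero; suc; _≤_; _+_)
open import Data.Fin using (Fin; _≟_)
open import Data.Bool using (Bool; true; false; if_then_else_; _∨_)
open import Data.List using (List; []; _∷_; _++_; [_]; filter; take; length)
open import Data.Bool.ListAction using (any)
open import Data.Unit using (⊤)
open import Data.List.Membership.Propositional using (_∈_)
open import Data.List.Relation.Unary.Unique.Propositional using (Unique)
open import Data.Product using (Σ; _×_; _,_; ∃; ∃-syntax)
open import Data.Sum using (_⊎_)
open import Data.Empty using (⊥)
open import Relation.Nullary using (¬_)
open import Relation.Nullary.Decidable using (⌊_⌋; _⊎-dec_)
open import Relation.Binary.PropositionalEquality using (_≡_; _≢_)
open import Function.Bundles using (_⇔_)

record Graph : Set₁ where
  field
    n     : ℕ
    E     : Fin n → Fin n → Set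
    sym   : ∀ {u v} → E u v → E v u
    irrefl : ∀ {u} → ¬ E u u
open Graph public

abPow : ∀ {A : Set} → ℕ → A → A → List A
abPow zero    a b = []
abPow (suc m) a b = a ∷ b ∷ abPow m a b

restrict : ∀ {n} → Fin n → Fin n → List (Fin n) → List (Fin n)
restrict a b w = filter (λ x → (x ≟ a) ⊎-dec (x ≟ b)) w

-- a and b alternate in w (meaningful for a ≢ b)
Alternate : ∀ {n} → Fin n → Fin n → List (Fin n) → Set
Alternate a b w =
  ∃[ m ] (1 ≤ m × ( restrict a b w ≡ abPow m a b
                  ⊎ restrict a b w ≡ abPow m a b ++ [ a ]
                  ⊎ restrict a b w ≡ abPow m b a
                  ⊎ restrict a b w ≡ abPow m b a ++ [ b ]))

Represents : (G : Graph) → List (Fin (n G)) → Set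
Represents G w =
  (∀ (a : Fin (n G)) → a ∈ w) ×
  (∀ (a b : Fin (n G)) → a ≢ b → (Alternate a b w ⇔ E G a b))

-- number of marked blocks (maximal factors of marked positions);
-- the Bool records whether the previous position was marked
blocksFrom : ∀ {n} → (Fin n → Bool) → Bool → List (Fin n) → ℕ
blocksFrom mk prev []      = 0
blocksFrom mk prev (x ∷ w) with mk x | prev
... | true  | false = suc (blocksFrom mk true w)
... | true  | true  = blocksFrom mk true w
... | false | _     = blocksFrom mk false w

blocks : ∀ {n} → (Fin n → Bool) → List (Fin n) → ℕ
blocks mk w = blocksFrom mk false w

markedAt : ∀ {n} → List (Fin n) → ℕ → Fin n → Bool
markedAt σ i x = any (λ y → ⌊ x ≟ y ⌋) (take i σ)

IsMarkingSeq : ∀ {n} → List (Fin n) → List (Fin n) → Set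
IsMarkingSeq w σ = Unique σ × (∀ a → (a ∈ σ ⇔ a ∈ w))

KLocal : ∀ {n} → ℕ → List (Fin n) → Set
KLocal k w = ∃[ σ ] (IsMarkingSeq w σ ×
                     (∀ i → i ≤ length σ → blocks (markedAt σ i) w ≤ k))

InL : ℕ → Graph → Set
InL k G = ∃[ w ] (Represents G w × KLocal k w)

data CwExpr (n m : ℕ) : Set where
  node : Fin n → Fin m → CwExpr n m
  _⊕_  : CwExpr n m → CwExpr n m → CwExpr n m
  η    : (i j : Fin m) → i ≢ j → CwExpr n m → CwExpr n m
  ρ    : (i j : Fin m) → CwExpr n m → CwExpr n m

module _ {n m : ℕ} where

  inV : CwExpr n m → Fin n → Bool
  inV (node v l)  u = ⌊ u ≟ v ⌋
  inV (e₁ ⊕ e₂)   u = inV e₁ u ∨ inV e₂ u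
  inV (η i j _ e) u = inV e u
  inV (ρ i j e)   u = inV e u

  -- label of a vertex (meaningful on vertices)
  label : CwExpr n m → Fin n → Fin m
  label (node v l)  u = l
  label (e₁ ⊕ e₂)   u = if inV e₁ u then label e₁ u else label e₂ u
  label (η i j _ e) u = label e u
  label (ρ i j e)   u = if ⌊ label e u ≟ i ⌋ then j else label e u

  edge : CwExpr n m → Fin n → Fin n → Set
  edge (node v l)  u u' = ⊥
  edge (e₁ ⊕ e₂)   u u' = edge e₁ u u' ⊎ edge e₂ u u'
  edge (η i j _ e) u u' =
    edge e u u' ⊎
    (inV e u ≡ true × inV e u' ≡ true ×
      ((label e u ≡ i × label e u' ≡ j) ⊎ (label e u ≡ j × label e u' ≡ i)))
  edge (ρ i j e)   u u' = edge e u u'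

  WF : CwExpr n m → Set
  WF (node v l)  = ⊤
  WF (e₁ ⊕ e₂)   = WF e₁ × WF e₂ × (∀ u → inV e₁ u ≡ true → inV e₂ u ≡ false)
  WF (η i j _ e) = WF e
  WF (ρ i j e)   = WF e

-- cwd(G) ≤ m : some expression with at most m labels produces a labelled
-- version of G (the empty graph has clique-width 0)
CwdLe : Graph → ℕ → Set
CwdLe G m =
  n G ≡ 0 ⊎
  ∃[ e ] (WF {n G} {m} e ×
          (∀ u → inV e u ≡ true) ×
          (∀ u v → (edge e u v ⇔ E G u v)))

{-# OPTIONS --safe #-}
module Submission where

open import Algebra.Definitions using (IdempotentFun)
open import Data.Bool as Bool using (Bool; true; false; if_then_else_; _∧_; _∨_)
open import Data.Bool.ListAction using (any)
open import Data.Bool.Properties using (∨-zeroʳ; T-≡; ¬-not)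
open import Data.Empty using (⊥)
open import Data.Fin as Fin using (Fin; _≟_; inject≤; funToFin; finToFun)
open import Data.Fin.Properties
  using (inject≤-injective; finToFun-funToFin; inject₁-injective; fromℕ≢inject₁; pigeonhole; ¬∀⟶∃¬; <-irrefl)
open import Data.List as List using (List; []; _∷_; _++_; [_]; filter; replicate; length; take; allFin)
open import Data.List.Properties
  using (map-++; filter-++; map-replicate; ∷-injectiveˡ; ∷-injectiveʳ; ≡-dec; ++-identityʳ; ++-assoc; length-++-≤ˡ)
open import Data.List.Relation.Unary.All as All using (All; []; _∷_)
import Data.List.Relation.Unary.All.Properties as Allₚ
open import Data.List.Relation.Unary.AllPairs using (_∷_)
open import Data.List.Relation.Unary.Any as Any using (Any; here; there)
open import Data.List.Relation.Unary.Any.Properties using (¬Any[]; any⁺; any⁻)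
open import Data.List.Relation.Unary.Linked as Linked using (Linked; []; [-]; _∷_)
open import Data.List.Relation.Unary.Unique.Propositional using (Unique)
open import Data.List.Membership.Propositional as Membership using (_∈_; _∉_; lose)
open import Data.List.Membership.Propositional.Properties
  using (∈-++⁻; ∈-++⁺ˡ; ∈-++⁺ʳ; ∈-allFin; ∈-map⁺; ∈-map⁻; ∈-filter⁺; ∈-filter⁻)
open import Data.Maybe using (Maybe; just; nothing; maybe′; fromMaybe)
open import Data.Nat using (ℕ; zero; suc; _+_; _≤_; _≤?_; _^_; z≤n; s≤s)
open import Data.Nat.Properties using (^-monoʳ-≤; n<1+n; m≤n⇒m≤1+n; ≤-trans; anyUpTo?; +-comm)
open import Data.Product as Product using (_×_; _,_; ∃-syntax; Σ-syntax; ∃₂; proj₁; proj₂)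
open import Data.Sum as Sum using (_⊎_; inj₁; inj₂; [_,_]′)
open import Data.Unit using (tt)
open import Data.Vec as Vec using (Vec)
import Data.Vec.Properties as Vecₚ
import Data.Vec.Relation.Unary.All as VecAll
open import Function using (_∘_; _⇔_; mk⇔; Equivalence)
open import Level using (0ℓ)
open import Relation.Binary using (Rel; DecidableEquality)
open import Relation.Binary.PropositionalEquality
  using (_≡_; _≢_; refl; trans; cong; cong₂; subst; subst₂; ≢-sym)
import Relation.Binary.PropositionalEquality as ≡
open import Relation.Nullary using (¬_; Dec; yes; no; contradiction)
open import Relation.Nullary.Decidable as Dec
  using (⌊_⌋; map′; _×-dec_; _⊎-dec_; toWitness; fromWitness; does-⇔; isYes≗does)
open import Relation.Unary as U using (Pred)

open import Defs

-- Fix a marking sequence σ witnessing k-locality and look at the stage where a prefix of σ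
-- is marked. A marked letter x that occurs twice in one marked block alternates with no unmarked letter;
-- otherwise the 0/1 vector recording in which of the at most k blocks x occurs determines, for every
-- unmarked y, the word obtained by restricting to x and y up to renaming x. Hence the vertices of every
-- prefix of σ fall into at most 2^k classes with equal neighbourhoods in the remaining suffix.
-- Inserting the vertices in the order σ, keep an expression for the induced graph on the prefix whose
-- labels are these classes: the new vertex enters with one further, spare label, is joined to the labels
-- of its neighbours, labels that became twins are merged, and the new vertex moves to its class label.

Linked-++⁻ˡ : ∀ {A : Set} {ℓ} {R : Rel A ℓ} xs {ys} → Linked R (xs ++ ys) → Linked R xs
Linked-++⁻ˡ []           _       = []
Linked-++⁻ˡ (x ∷ [])     _       = [-]
Linked-++⁻ˡ (x ∷ y ∷ xs) (r ∷ l) = r ∷ Linked-++⁻ˡ (y ∷ xs) l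

Linked-++⁻ʳ : ∀ {A : Set} {ℓ} {R : Rel A ℓ} xs {ys} → Linked R (xs ++ ys) → Linked R ys
Linked-++⁻ʳ []       l = l
Linked-++⁻ʳ (x ∷ xs) l = Linked-++⁻ʳ xs (Linked.tail l)

∈-snoc⁻ : ∀ {A : Set} xs {a x : A} → x ∈ xs ++ [ a ] → x ∈ xs ⊎ x ≡ a
∈-snoc⁻ xs x∈ = Sum.map₂ (λ { (here x≡a) → x≡a }) (∈-++⁻ xs x∈)

Unique-++-disjoint : ∀ {A : Set} xs {ys} {y : A} → Unique (xs ++ ys) → y ∈ ys → y ∉ xs
Unique-++-disjoint (x ∷ xs) (x∉ ∷ _) y∈ (here refl)  = All.lookup (Allₚ.++⁻ʳ xs x∉) y∈ refl
Unique-++-disjoint (x ∷ xs) (_ ∷ u)  y∈ (there y∈xs) = Unique-++-disjoint xs u y∈ y∈xs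

take-length-++ : ∀ {A : Set} (xs : List A) {ys} → take (length xs) (xs ++ ys) ≡ xs
take-length-++ []       = refl
take-length-++ (x ∷ xs) = cong (x ∷_) (take-length-++ xs)

module _ {A : Set} {P : Pred A 0ℓ} (P? : U.Decidable P) where

  find-sound : ∀ {xs x} → List.find P? xs ≡ just x → x ∈ xs × P x
  find-sound {y ∷ xs} eq with P? y
  ... | yes py with refl ← eq = here refl , py
  ... | no _   = Product.map₁ there (find-sound eq)

  find-complete : ∀ {xs} → Any P xs → ∃[ x ] List.find P? xs ≡ just x
  find-complete {y ∷ xs} p with P? y | p
  ... | yes _   | _        = y , refl
  ... | no ¬py | here py  = contradiction py ¬py
  ... | no _    | there p′ = find-complete p′

  find-none : ∀ {xs} → All (¬_ ∘ P) xs → List.find P? xs ≡ nothing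
  find-none []                     = refl
  find-none {y ∷ xs} (¬py ∷ ¬ps) with P? y
  ... | yes py = contradiction py ¬py
  ... | no _   = find-none ¬ps

isYes⇒ : ∀ {P : Set} (p? : Dec P) → ⌊ p? ⌋ ≡ true → P
isYes⇒ (yes p) _ = p

⇒isYes : ∀ {P : Set} (p? : Dec P) → P → ⌊ p? ⌋ ≡ true
⇒isYes (yes _) _ = refl
⇒isYes (no ¬p) p = contradiction p ¬p

⇒isNo : ∀ {P : Set} (p? : Dec P) → ¬ P → ⌊ p? ⌋ ≡ false
⇒isNo (yes p) ¬p = contradiction p ¬p
⇒isNo (no _)  _  = refl

isYes-⇔ : ∀ {P Q : Set} → P ⇔ Q → (p? : Dec P) (q? : Dec Q) → ⌊ p? ⌋ ≡ ⌊ q? ⌋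
isYes-⇔ P⇔Q p? q? = trans (isYes≗does p?) (trans (does-⇔ P⇔Q p? q?) (≡.sym (isYes≗does q?)))

any≟⇔∈ : ∀ {n} {x : Fin n} xs → any (λ y → ⌊ x ≟ y ⌋) xs ≡ true ⇔ x ∈ xs
any≟⇔∈ xs = mk⇔ (λ eq → Any.map toWitness (any⁻ _ xs (Equivalence.from T-≡ eq)))
                (λ x∈ → Equivalence.to T-≡ (any⁺ _ (Any.map fromWitness x∈)))

module _ {n : ℕ} where

  abPow-snoc-linked : ∀ {a b : Fin n} → a ≢ b → ∀ m → Linked _≢_ (abPow m a b ++ [ a ])
  abPow-snoc-linked a≢b zero          = [-]
  abPow-snoc-linked a≢b (suc zero)    = a≢b ∷ ≢-sym a≢b ∷ [-]
  abPow-snoc-linked a≢b (suc (suc m)) = a≢b ∷ ≢-sym a≢b ∷ abPow-snoc-linked a≢b (suc m)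

  abPow-linked : ∀ {a b : Fin n} → a ≢ b → ∀ m → Linked _≢_ (abPow m a b)
  abPow-linked {a} {b} a≢b m = Linked-++⁻ˡ (abPow m a b) (abPow-snoc-linked a≢b m)

  Alternate⇒Linked : ∀ {a b : Fin n} {w} → a ≢ b → Alternate a b w → Linked _≢_ (restrict a b w)
  Alternate⇒Linked a≢b (m , _ , inj₁ r≡) =
    subst (Linked _≢_) (≡.sym r≡) (abPow-linked a≢b m)
  Alternate⇒Linked a≢b (m , _ , inj₂ (inj₁ r≡)) =
    subst (Linked _≢_) (≡.sym r≡) (abPow-snoc-linked a≢b m)
  Alternate⇒Linked a≢b (m , _ , inj₂ (inj₂ (inj₁ r≡))) =
    subst (Linked _≢_) (≡.sym r≡) (abPow-linked (≢-sym a≢b) m)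
  Alternate⇒Linked a≢b (m , _ , inj₂ (inj₂ (inj₂ r≡))) =
    subst (Linked _≢_) (≡.sym r≡) (abPow-snoc-linked (≢-sym a≢b) m)

  map-abPow : ∀ (f : Fin n → Fin n) {a b a' b'} → f a ≡ a' → f b ≡ b' → ∀ m →
              List.map f (abPow m a b) ≡ abPow m a' b'
  map-abPow f fa fb zero    = refl
  map-abPow f fa fb (suc m) = cong₂ _∷_ fa (cong₂ _∷_ fb (map-abPow f fa fb m))

  map-abPow-snoc : ∀ (f : Fin n → Fin n) {a b a' b'} → f a ≡ a' → f b ≡ b' → ∀ m →
                   List.map f (abPow m a b ++ [ a ]) ≡ abPow m a' b' ++ [ a' ]
  map-abPow-snoc f fa fb m = trans (map-++ f (abPow m _ _) [ _ ]) (cong₂ _++_ (map-abPow f fa fb m) (cong [_] fa))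

  Alternate-map : ∀ {a a' b : Fin n} {w} (f : Fin n → Fin n) → f a ≡ a' → f b ≡ b →
                  restrict a' b w ≡ List.map f (restrict a b w) → Alternate a b w → Alternate a' b w
  Alternate-map {a} {a'} {b} {w} f fa fb eq (m , 1≤m , shape) =
    m , 1≤m , Sum.map (via (map-abPow f fa fb m))
               (Sum.map (via (map-abPow-snoc f fa fb m))
                 (Sum.map (via (map-abPow f fb fa m)) (via (map-abPow-snoc f fb fa m)))) shape
    where
    via : ∀ {xs ys} → List.map f xs ≡ ys → restrict a b w ≡ xs → restrict a' b w ≡ ys
    via f≡ r≡ = trans eq (trans (cong (List.map f) r≡) f≡)

  rename : Fin n → Fin n → Fin n → Fin n
  rename x x' z = if ⌊ z ≟ x ⌋ then x' else z

  rename-same : ∀ x x' → rename x x' x ≡ x'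
  rename-same x x' with x ≟ x
  ... | yes _   = refl
  ... | no x≢x = contradiction refl x≢x

  rename-other : ∀ {x z} x' → z ≢ x → rename x x' z ≡ z
  rename-other {x} {z} x' z≢x with z ≟ x
  ... | yes z≡x = contradiction z≡x z≢x
  ... | no _    = refl

  restrict-++ : ∀ (x y : Fin n) xs ys → restrict x y (xs ++ ys) ≡ restrict x y xs ++ restrict x y ys
  restrict-++ x y = filter-++ _

abPow-length : ∀ {n} (a b : Fin n) m → m ≤ length (abPow m a b)
abPow-length a b zero    = z≤n
abPow-length a b (suc m) = s≤s (m≤n⇒m≤1+n (abPow-length a b m))

abPow-snoc-length : ∀ {n} (a b : Fin n) m → m ≤ length (abPow m a b ++ [ a ])
abPow-snoc-length a b m = ≤-trans (abPow-length a b m) (length-++-≤ˡ (abPow m a b))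

Alternate? : ∀ {n} (a b : Fin n) w → Dec (Alternate a b w)
Alternate? {n} a b w =
  map′ (λ (m , _ , alt) → m , alt) (λ (m , alt) → m , s≤s (bound (proj₂ alt)) , alt)
       (anyUpTo? shape? (suc (length r)))
  where
  r : List (Fin n)
  r = restrict a b w
  _≟ₗ_ : DecidableEquality (List (Fin n))
  _≟ₗ_ = ≡-dec _≟_
  Shape : ℕ → Set
  Shape m = r ≡ abPow m a b ⊎ r ≡ abPow m a b ++ [ a ] ⊎ r ≡ abPow m b a ⊎ r ≡ abPow m b a ++ [ b ]
  shape? : ∀ m → Dec (1 ≤ m × Shape m)
  shape? m = (1 ≤? m) ×-dec (r ≟ₗ abPow m a b ⊎-dec r ≟ₗ (abPow m a b ++ [ a ]) ⊎-dec
                             r ≟ₗ abPow m b a ⊎-dec r ≟ₗ (abPow m b a ++ [ b ]))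
  bound : ∀ {m} → Shape m → m ≤ length r
  bound {m} (inj₁ eq)               = subst ((m ≤_) ∘ length) (≡.sym eq) (abPow-length a b m)
  bound {m} (inj₂ (inj₁ eq))        = subst ((m ≤_) ∘ length) (≡.sym eq) (abPow-snoc-length a b m)
  bound {m} (inj₂ (inj₂ (inj₁ eq))) = subst ((m ≤_) ∘ length) (≡.sym eq) (abPow-length b a m)
  bound {m} (inj₂ (inj₂ (inj₂ eq))) = subst ((m ≤_) ∘ length) (≡.sym eq) (abPow-snoc-length b a m)

Represents⇒E? : ∀ {G w} → Represents G w → ∀ u v → Dec (E G u v)
Represents⇒E? {G} {w} (_ , alternate⇔E) u v with u ≟ v
... | yes refl = no (irrefl G)
... | no u≢v   = Dec.map (alternate⇔E u v u≢v) (Alternate? u v w)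

count : ∀ {n} → Fin n → List (Fin n) → ℕ
count x = length ∘ filter (_≟ x)

∈⇒count≢0 : ∀ {n} {x : Fin n} {B} → x ∈ B → count x B ≢ 0
∈⇒count≢0 {x = x} {z ∷ B} x∈ with z ≟ x
... | yes _ = λ ()
... | no z≢x with x∈
...   | here x≡z  = contradiction (≡.sym x≡z) z≢x
...   | there x∈B = ∈⇒count≢0 x∈B

bit : ℕ → Fin 2
bit zero    = Fin.zero
bit (suc _) = Fin.suc Fin.zero

map-bit-injective : ∀ {r} {cs cs' : Vec ℕ r} → VecAll.All (_≤ 1) cs → VecAll.All (_≤ 1) cs' →
                    Vec.map bit cs ≡ Vec.map bit cs' → cs ≡ cs'
map-bit-injective VecAll.[] VecAll.[] _ = refl
map-bit-injective (c≤1 VecAll.∷ cs≤1) (c'≤1 VecAll.∷ cs'≤1) eq =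
  cong₂ Vec._∷_ (bit-injective c≤1 c'≤1 (Vecₚ.∷-injectiveˡ eq))
                (map-bit-injective cs≤1 cs'≤1 (Vecₚ.∷-injectiveʳ eq))
  where
  bit-injective : ∀ {c c'} → c ≤ 1 → c' ≤ 1 → bit c ≡ bit c' → c ≡ c'
  bit-injective z≤n       z≤n       _  = refl
  bit-injective (s≤s z≤n) (s≤s z≤n) _  = refl
  bit-injective z≤n       (s≤s z≤n) ()
  bit-injective (s≤s z≤n) z≤n       ()

map-bit-zero : ∀ {r} (cs : Vec ℕ r) → Vec.map bit cs ≡ Vec.replicate r Fin.zero → cs ≡ Vec.replicate r 0
map-bit-zero Vec.[]             _  = refl
map-bit-zero (zero Vec.∷ cs)    eq = cong (0 Vec.∷_) (map-bit-zero cs (Vecₚ.∷-injectiveʳ eq))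
map-bit-zero (suc _ Vec.∷ cs)   ()

-- All zero when a count exceeds 1: such a letter alternates with no unmarked letter at all.
occurrenceBits : ∀ {r} → Vec ℕ r → Vec (Fin 2) r
occurrenceBits cs with VecAll.all? (_≤? 1) cs
... | yes _ = Vec.map bit cs
... | no _  = Vec.replicate _ Fin.zero

occurrenceBits-≤1 : ∀ {r} {cs : Vec ℕ r} → VecAll.All (_≤ 1) cs → occurrenceBits cs ≡ Vec.map bit cs
occurrenceBits-≤1 {cs = cs} cs≤1 with VecAll.all? (_≤? 1) cs
... | yes _     = refl
... | no ¬cs≤1 = contradiction cs≤1 ¬cs≤1

occurrenceBits-≰1 : ∀ {r} {cs : Vec ℕ r} → ¬ VecAll.All (_≤ 1) cs →
                    occurrenceBits cs ≡ Vec.replicate r Fin.zero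
occurrenceBits-≰1 {cs = cs} ¬cs≤1 with VecAll.all? (_≤? 1) cs
... | yes cs≤1 = contradiction cs≤1 ¬cs≤1
... | no _     = refl

encode : ∀ {r} → Vec (Fin 2) r → Fin (2 ^ r)
encode v = funToFin (Vec.lookup v)

encode-injective : ∀ {r} {u v : Vec (Fin 2) r} → encode u ≡ encode v → u ≡ v
encode-injective {u = u} {v} eq = begin
  u                           ≡⟨ Vecₚ.tabulate∘lookup u ⟨
  Vec.tabulate (Vec.lookup u) ≡⟨ Vecₚ.tabulate-cong lookup≗ ⟩
  Vec.tabulate (Vec.lookup v) ≡⟨ Vecₚ.tabulate∘lookup v ⟩
  v                           ∎
  where
  open ≡.≡-Reasoning
  lookup≗ : ∀ i → Vec.lookup u i ≡ Vec.lookup v i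
  lookup≗ i = trans (≡.sym (finToFun-funToFin (Vec.lookup u) i))
                    (trans (cong (λ c → finToFun c i) eq) (finToFun-funToFin (Vec.lookup v) i))

module Blocks {n : ℕ} (marked : Fin n → Bool) where

  data Token : Set where
    letter : Fin n → Token
    block  : List (Fin n) → Token

  WellMarked : Token → Set
  WellMarked (letter z) = marked z ≡ false
  WellMarked (block B)  = All (λ z → marked z ≡ true) B

  flatten : List Token → List (Fin n)
  flatten []              = []
  flatten (letter z ∷ ts) = z ∷ flatten ts
  flatten (block B ∷ ts)  = B ++ flatten ts

  blockCount : List Token → ℕ
  blockCount []              = 0
  blockCount (letter _ ∷ ts) = blockCount ts
  blockCount (block _ ∷ ts)  = suc (blockCount ts)

  startsWithBlock : List Token → Bool
  startsWithBlock (block _ ∷ _) = true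
  startsWithBlock _             = false

  consMarked : Fin n → List Token → List Token
  consMarked z (block B ∷ ts) = block (z ∷ B) ∷ ts
  consMarked z ts             = block [ z ] ∷ ts

  tokenize : List (Fin n) → List Token
  tokenize []      = []
  tokenize (z ∷ w) = if marked z then consMarked z (tokenize w) else letter z ∷ tokenize w

  tokenize-wellMarked : ∀ w → All WellMarked (tokenize w)
  tokenize-wellMarked []      = []
  tokenize-wellMarked (z ∷ w) with marked z in mz | tokenize w | tokenize-wellMarked w
  ... | false | _            | wm      = mz ∷ wm
  ... | true  | []           | wm      = (mz ∷ []) ∷ wm
  ... | true  | letter _ ∷ _ | wm      = (mz ∷ []) ∷ wm
  ... | true  | block _ ∷ _  | mB ∷ wm = (mz ∷ mB) ∷ wm

  flatten-consMarked : ∀ z ts → flatten (consMarked z ts) ≡ z ∷ flatten ts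
  flatten-consMarked z []              = refl
  flatten-consMarked z (letter _ ∷ ts) = refl
  flatten-consMarked z (block _ ∷ ts)  = refl

  flatten-tokenize : ∀ w → flatten (tokenize w) ≡ w
  flatten-tokenize []      = refl
  flatten-tokenize (z ∷ w) with marked z
  ... | true  = trans (flatten-consMarked z (tokenize w)) (cong (z ∷_) (flatten-tokenize w))
  ... | false = cong (z ∷_) (flatten-tokenize w)

  startsWithBlock-consMarked : ∀ z ts → startsWithBlock (consMarked z ts) ≡ true
  startsWithBlock-consMarked z []              = refl
  startsWithBlock-consMarked z (letter _ ∷ ts) = refl
  startsWithBlock-consMarked z (block _ ∷ ts)  = refl

  blockCount-consMarked : ∀ z ts {m} → blockCount ts ≡ (if startsWithBlock ts then suc m else m) →
                          blockCount (consMarked z ts) ≡ suc m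
  blockCount-consMarked z []              eq = cong suc eq
  blockCount-consMarked z (letter _ ∷ ts) eq = cong suc eq
  blockCount-consMarked z (block _ ∷ ts)  eq = eq

  -- With prev = true, blocksFrom omits a block continuing the previous letter.
  blockCount-tokenize : ∀ prev w →
    blockCount (tokenize w) ≡ (if prev ∧ startsWithBlock (tokenize w) then suc (blocksFrom marked prev w)
                                                                       else blocksFrom marked prev w)
  blockCount-tokenize false []      = refl
  blockCount-tokenize true  []      = refl
  blockCount-tokenize false (z ∷ w) with marked z
  ... | true  = blockCount-consMarked z (tokenize w) (blockCount-tokenize true w)
  ... | false = blockCount-tokenize false w
  blockCount-tokenize true  (z ∷ w) with marked z
  ... | true  = trans (blockCount-consMarked z (tokenize w) (blockCount-tokenize true w))
                      (cong (λ b → if b then _ else _) (≡.sym (startsWithBlock-consMarked z (tokenize w))))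
  ... | false = blockCount-tokenize false w

  marked-≢ : ∀ {x y} → marked x ≡ true → marked y ≡ false → x ≢ y
  marked-≢ mx my refl = contradiction (trans (≡.sym mx) my) λ ()

  restrict-block : ∀ {x y} → marked y ≡ false → ∀ {B} → All (λ z → marked z ≡ true) B →
                   restrict x y B ≡ replicate (count x B) x
  restrict-block my []                        = refl
  restrict-block {x} {y} my {z ∷ B} (mz ∷ mB) with z ≟ x | z ≟ y
  ... | yes refl | _       = cong (z ∷_) (restrict-block my mB)
  ... | no _     | yes z≡y = contradiction z≡y (marked-≢ mz my)
  ... | no _     | no _    = restrict-block my mB

  counts : Fin n → (ts : List Token) → Vec ℕ (blockCount ts)
  counts x []              = Vec.[]
  counts x (letter _ ∷ ts) = counts x ts
  counts x (block B ∷ ts)  = count x B Vec.∷ counts x ts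

  Linked⇒counts≤1 : ∀ {x y} → marked y ≡ false → ∀ {ts} → All WellMarked ts →
                    Linked _≢_ (restrict x y (flatten ts)) → VecAll.All (_≤ 1) (counts x ts)
  Linked⇒counts≤1 my [] _ = VecAll.[]
  Linked⇒counts≤1 {x} {y} my {letter z ∷ ts} (_ ∷ wm) l with z ≟ x | z ≟ y
  ... | yes _ | _     = Linked⇒counts≤1 my wm (Linked.tail l)
  ... | no _  | yes _ = Linked⇒counts≤1 my wm (Linked.tail l)
  ... | no _  | no _  = Linked⇒counts≤1 my wm l
  Linked⇒counts≤1 {x} {y} my {block B ∷ ts} (mB ∷ wm) l =
    atMostOnce (count x B) l′ VecAll.∷ Linked⇒counts≤1 my wm (Linked-++⁻ʳ (replicate (count x B) x) l′)
    where
    l′ : Linked _≢_ (replicate (count x B) x ++ restrict x y (flatten ts))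
    l′ = subst (Linked _≢_) (trans (restrict-++ x y B (flatten ts)) (cong (_++ _) (restrict-block my mB))) l
    atMostOnce : ∀ c {xs} → Linked _≢_ (replicate c x ++ xs) → c ≤ 1
    atMostOnce zero          _         = z≤n
    atMostOnce (suc zero)    _         = s≤s z≤n
    atMostOnce (suc (suc c)) (x≢x ∷ _) = contradiction refl x≢x

  restrict-rename : ∀ {x x' y} → marked x ≡ true → marked x' ≡ true → marked y ≡ false →
                    ∀ {ts} → All WellMarked ts → counts x ts ≡ counts x' ts →
                    restrict x' y (flatten ts) ≡ List.map (rename x x') (restrict x y (flatten ts))
  restrict-rename mx mx' my [] _ = refl
  restrict-rename {x} {x'} {y} mx mx' my {letter z ∷ ts} (mz ∷ wm) eq with z ≟ x' | z ≟ x | z ≟ y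
  ... | yes z≡x' | _       | _       = contradiction (≡.sym z≡x') (marked-≢ mx' mz)
  ... | no _     | yes z≡x | _       = contradiction (≡.sym z≡x) (marked-≢ mx mz)
  ... | no _     | no _    | yes refl =
    cong₂ _∷_ (≡.sym (rename-other x' (≢-sym (marked-≢ mx my)))) (restrict-rename mx mx' my wm eq)
  ... | no _     | no _    | no _    = restrict-rename mx mx' my wm eq
  restrict-rename {x} {x'} {y} mx mx' my {block B ∷ ts} (mB ∷ wm) eq = begin
    restrict x' y (B ++ flatten ts)                     ≡⟨ restrict-++ x' y B (flatten ts) ⟩
    restrict x' y B ++ restrict x' y (flatten ts)       ≡⟨ cong₂ _++_ (restrict-block my mB) rest≡ ⟩
    replicate (count x' B) x' ++ List.map f rest        ≡⟨ cong (_++ List.map f rest) block≡ ⟩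
    List.map f (restrict x y B) ++ List.map f rest      ≡⟨ map-++ f (restrict x y B) rest ⟨
    List.map f (restrict x y B ++ rest)                 ≡⟨ cong (List.map f) (restrict-++ x y B (flatten ts)) ⟨
    List.map f (restrict x y (B ++ flatten ts))         ∎
    where
    open ≡.≡-Reasoning
    f : Fin n → Fin n
    f = rename x x'
    rest : List (Fin n)
    rest = restrict x y (flatten ts)
    rest≡ : restrict x' y (flatten ts) ≡ List.map f rest
    rest≡ = restrict-rename mx mx' my wm (Vecₚ.∷-injectiveʳ eq)
    block≡ : replicate (count x' B) x' ≡ List.map f (restrict x y B)
    block≡ = begin
      replicate (count x' B) x'            ≡⟨ cong₂ replicate (Vecₚ.∷-injectiveˡ eq) (rename-same x x') ⟨
      replicate (count x B) (f x)          ≡⟨ map-replicate f (count x B) x ⟨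
      List.map f (replicate (count x B) x) ≡⟨ cong (List.map f) (restrict-block my mB) ⟨
      List.map f (restrict x y B)          ∎

  zeroCounts⇒∉ : ∀ {x} → marked x ≡ true → ∀ {ts} → All WellMarked ts →
                 counts x ts ≡ Vec.replicate _ 0 → x ∉ flatten ts
  zeroCounts⇒∉ mx {letter z ∷ ts} (mz ∷ wm) none (here x≡z)  = marked-≢ mx mz x≡z
  zeroCounts⇒∉ mx {letter z ∷ ts} (mz ∷ wm) none (there x∈) = zeroCounts⇒∉ mx wm none x∈
  zeroCounts⇒∉ mx {block B ∷ ts}  (_ ∷ wm)  none x∈ with ∈-++⁻ B x∈
  ... | inj₁ x∈B = ∈⇒count≢0 x∈B (Vecₚ.∷-injectiveˡ none)
  ... | inj₂ x∈  = zeroCounts⇒∉ mx wm (Vecₚ.∷-injectiveʳ none) x∈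

module _ {n : ℕ} (marked : Fin n → Bool) (w : List (Fin n)) {k : ℕ} (few : blocks marked w ≤ k) where
  open Blocks marked

  blockType : Fin n → Fin (2 ^ k)
  blockType x = inject≤ (encode (occurrenceBits (counts x (tokenize w))))
                        (^-monoʳ-≤ 2 (subst (_≤ k) (≡.sym (blockCount-tokenize false w)) few))

  blockType-Alternate : ∀ {x x' y} → marked x ≡ true → marked x' ≡ true → marked y ≡ false → x ∈ w →
                        blockType x ≡ blockType x' → Alternate x y w → Alternate x' y w
  blockType-Alternate {x} {x'} {y} mx mx' my x∈w same alt = byCounts (VecAll.all? (_≤? 1) (counts x' ts))
    where
    ts : List Token
    ts = tokenize w
    wm : All WellMarked ts
    wm = tokenize-wellMarked w
    bits≡ : occurrenceBits (counts x ts) ≡ occurrenceBits (counts x' ts)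
    bits≡ = encode-injective (inject≤-injective _ _ _ _ same)
    cs≤1 : VecAll.All (_≤ 1) (counts x ts)
    cs≤1 = Linked⇒counts≤1 my wm (subst (Linked _≢_ ∘ restrict x y) (≡.sym (flatten-tokenize w))
                                        (Alternate⇒Linked {w = w} (marked-≢ mx my) alt))
    byCounts : Dec (VecAll.All (_≤ 1) (counts x' ts)) → Alternate x' y w
    byCounts (yes cs'≤1) =
      Alternate-map {w = w} (rename x x') (rename-same x x') (rename-other x' (≢-sym (marked-≢ mx my)))
                    restrict≡ alt
      where
      counts≡ : counts x ts ≡ counts x' ts
      counts≡ = map-bit-injective cs≤1 cs'≤1
                  (trans (≡.sym (occurrenceBits-≤1 cs≤1)) (trans bits≡ (occurrenceBits-≤1 cs'≤1)))
      restrict≡ : restrict x' y w ≡ List.map (rename x x') (restrict x y w)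
      restrict≡ = subst (λ v → restrict x' y v ≡ List.map (rename x x') (restrict x y v)) (flatten-tokenize w)
                        (restrict-rename mx mx' my wm counts≡)
    byCounts (no ¬cs'≤1) =
      contradiction (subst (x ∈_) (≡.sym (flatten-tokenize w)) x∈w) (zeroCounts⇒∉ mx wm counts≡0)
      where
      counts≡0 : counts x ts ≡ Vec.replicate _ 0
      counts≡0 = map-bit-zero (counts x ts)
                   (trans (≡.sym (occurrenceBits-≤1 cs≤1)) (trans bits≡ (occurrenceBits-≰1 ¬cs'≤1)))

blockType-E : ∀ {G w} (marked : Fin (n G) → Bool) {k} (few : blocks marked w ≤ k) → Represents G w →
              ∀ {x x' y} → marked x ≡ true → marked x' ≡ true → marked y ≡ false →
              blockType marked w few x ≡ blockType marked w few x' → E G x y → E G x' y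
blockType-E marked few (covers , alternate⇔E) mx mx' my same exy =
  Equivalence.to (alternate⇔E _ _ (marked-≢ mx' my))
    (blockType-Alternate marked _ few mx mx' my (covers _) same
      (Equivalence.from (alternate⇔E _ _ (marked-≢ mx my)) exy))
  where open Blocks marked using (marked-≢)

SameNeighbours : (G : Graph) → List (Fin (n G)) → Fin (n G) → Fin (n G) → Set
SameNeighbours G R u v = ∀ {y} → y ∈ R → (E G u y ⇔ E G v y)

NeighbourClasses≤ : ℕ → (G : Graph) → (P R : List (Fin (n G))) → Set
NeighbourClasses≤ L G P R =
  Σ[ t ∈ (Fin (n G) → Fin L) ] (∀ {u v} → u ∈ P → v ∈ P → t u ≡ t v → SameNeighbours G R u v)

markedAt-prefix : ∀ {n} {σ pre rest : List (Fin n)} {x} → σ ≡ pre ++ rest →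
                  markedAt σ (length pre) x ≡ true ⇔ x ∈ pre
markedAt-prefix {pre = pre} {rest} refl rewrite take-length-++ pre {rest} = any≟⇔∈ pre

marking⇒NeighbourClasses≤ : ∀ {k G w σ} → Represents G w → Unique σ →
                            (∀ i → i ≤ length σ → blocks (markedAt σ i) w ≤ k) →
                            ∀ pre rest → σ ≡ pre ++ rest → NeighbourClasses≤ (2 ^ k) G pre rest
marking⇒NeighbourClasses≤ {k} {G} {w} {σ} represents σ-unique local pre rest σ≡ =
  blockType marked w few , λ x∈ x'∈ same y∈ →
    mk⇔ (blockType-E {G} marked few represents (marked-pre x∈) (marked-pre x'∈) (unmarked-rest y∈) same)
        (blockType-E {G} marked few represents (marked-pre x'∈) (marked-pre x∈) (unmarked-rest y∈) (≡.sym same))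
  where
  marked : Fin (n G) → Bool
  marked = markedAt σ (length pre)
  few : blocks marked w ≤ k
  few = local (length pre) (subst ((length pre ≤_) ∘ length) (≡.sym σ≡) (length-++-≤ˡ pre))
  marked-pre : ∀ {x} → x ∈ pre → marked x ≡ true
  marked-pre = Equivalence.from (markedAt-prefix σ≡)
  unmarked-rest : ∀ {y} → y ∈ rest → marked y ≡ false
  unmarked-rest y∈ =
    ¬-not (Unique-++-disjoint pre (subst Unique σ≡ σ-unique) y∈ ∘ Equivalence.to (markedAt-prefix σ≡))

module _ {n m : ℕ} where
  open import Data.List.Membership.DecPropositional (_≟_ {m}) using (_∈?_)

  SamePair : (a b i j : Fin m) → Set
  SamePair a b i j = (a ≡ i × b ≡ j) ⊎ (a ≡ j × b ≡ i)

  SamePair-sym : ∀ {a b i j} → SamePair a b i j → SamePair b a i j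
  SamePair-sym (inj₁ (a≡i , b≡j)) = inj₂ (b≡j , a≡i)
  SamePair-sym (inj₂ (a≡j , b≡i)) = inj₁ (b≡i , a≡j)

  ρ-label-≢ : ∀ {i j} (e : CwExpr n m) {u} → label e u ≢ i → label (ρ i j e) u ≡ label e u
  ρ-label-≢ {i} e {u} ≢i with label e u ≟ i
  ... | yes ≡i = contradiction ≡i ≢i
  ... | no _   = refl

  ρ-label-≡ : ∀ {i j} (e : CwExpr n m) {u} → label e u ≡ i → label (ρ i j e) u ≡ j
  ρ-label-≡ {i} e {u} ≡i with label e u ≟ i
  ... | yes _  = refl
  ... | no ≢i  = contradiction ≡i ≢i

  joinAll : Fin m → List (Fin m) → CwExpr n m → CwExpr n m
  joinAll s []       e = e
  joinAll s (l ∷ ls) e with l ≟ s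
  ... | yes _   = joinAll s ls e
  ... | no l≢s = η s l (≢-sym l≢s) (joinAll s ls e)

  Joined : Fin m → List (Fin m) → CwExpr n m → Fin n → Fin n → Set
  Joined s ls e u v = inV e u ≡ true × inV e v ≡ true ×
                      ∃[ l ] (l ∈ ls × l ≢ s × SamePair (label e u) (label e v) s l)

  Joined-swap : ∀ {s ls} e {u v} → Joined s ls e u v → Joined s ls e v u
  Joined-swap _ (iu , iv , l , l∈ , l≢s , pair) = iv , iu , l , l∈ , l≢s , SamePair-sym pair

  Joined-there : ∀ {s l ls} e {u v} → Joined s ls e u v → Joined s (l ∷ ls) e u v
  Joined-there _ (iu , iv , l′ , l′∈ , l′≢s , pair) = iu , iv , l′ , there l′∈ , l′≢s , pair

  joinAll-inV : ∀ s ls e u → inV (joinAll s ls e) u ≡ inV e u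
  joinAll-inV s []       e u = refl
  joinAll-inV s (l ∷ ls) e u with l ≟ s
  ... | yes _ = joinAll-inV s ls e u
  ... | no _  = joinAll-inV s ls e u

  joinAll-label : ∀ s ls e u → label (joinAll s ls e) u ≡ label e u
  joinAll-label s []       e u = refl
  joinAll-label s (l ∷ ls) e u with l ≟ s
  ... | yes _ = joinAll-label s ls e u
  ... | no _  = joinAll-label s ls e u

  joinAll-WF : ∀ s ls {e} → WF e → WF (joinAll s ls e)
  joinAll-WF s []       wf = wf
  joinAll-WF s (l ∷ ls) wf with l ≟ s
  ... | yes _ = joinAll-WF s ls wf
  ... | no _  = joinAll-WF s ls wf

  joinAll-edge⁻ : ∀ s ls e {u v} → edge (joinAll s ls e) u v → edge e u v ⊎ Joined s ls e u v
  joinAll-edge⁻ s []       e uv = inj₁ uv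
  joinAll-edge⁻ s (l ∷ ls) e uv with l ≟ s
  ... | yes _ = Sum.map₂ (Joined-there e) (joinAll-edge⁻ s ls e uv)
  joinAll-edge⁻ s (l ∷ ls) e (inj₁ uv) | no _ = Sum.map₂ (Joined-there e) (joinAll-edge⁻ s ls e uv)
  joinAll-edge⁻ s (l ∷ ls) e {u} {v} (inj₂ (iu , iv , pair)) | no l≢s =
    inj₂ (trans (≡.sym (joinAll-inV s ls e u)) iu , trans (≡.sym (joinAll-inV s ls e v)) iv ,
          l , here refl , l≢s ,
          subst₂ (λ a b → SamePair a b s l) (joinAll-label s ls e u) (joinAll-label s ls e v) pair)

  joinAll-edge⁺ˡ : ∀ s ls e {u v} → edge e u v → edge (joinAll s ls e) u v
  joinAll-edge⁺ˡ s []       e uv = uv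
  joinAll-edge⁺ˡ s (l ∷ ls) e uv with l ≟ s
  ... | yes _ = joinAll-edge⁺ˡ s ls e uv
  ... | no _  = inj₁ (joinAll-edge⁺ˡ s ls e uv)

  joinAll-edge⁺ʳ : ∀ s ls e {u v} → Joined s ls e u v → edge (joinAll s ls e) u v
  joinAll-edge⁺ʳ s (l ∷ ls) e {u} {v} (iu , iv , l′ , l′∈ , l′≢s , pair) with l ≟ s | l′∈
  ... | yes l≡s | here refl  = contradiction l≡s l′≢s
  ... | yes _   | there l′∈ls = joinAll-edge⁺ʳ s ls e (iu , iv , l′ , l′∈ls , l′≢s , pair)
  ... | no _    | there l′∈ls = inj₁ (joinAll-edge⁺ʳ s ls e (iu , iv , l′ , l′∈ls , l′≢s , pair))
  ... | no _    | here refl  =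
    inj₂ (trans (joinAll-inV s ls e u) iu , trans (joinAll-inV s ls e v) iv ,
          subst₂ (λ a b → SamePair a b s l)
                 (≡.sym (joinAll-label s ls e u)) (≡.sym (joinAll-label s ls e v)) pair)

  relabelAll : (Fin m → Fin m) → List (Fin m) → CwExpr n m → CwExpr n m
  relabelAll h []       e = e
  relabelAll h (l ∷ ls) e = ρ l (h l) (relabelAll h ls e)

  relabelAll-inV : ∀ h ls e u → inV (relabelAll h ls e) u ≡ inV e u
  relabelAll-inV h []       e u = refl
  relabelAll-inV h (l ∷ ls) e u = relabelAll-inV h ls e u

  relabelAll-edge : ∀ h ls e u v → edge (relabelAll h ls e) u v ≡ edge e u v
  relabelAll-edge h []       e u v = refl
  relabelAll-edge h (l ∷ ls) e u v = relabelAll-edge h ls e u v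

  relabelAll-WF : ∀ h ls {e} → WF e → WF (relabelAll h ls e)
  relabelAll-WF h []       wf = wf
  relabelAll-WF h (l ∷ ls) wf = relabelAll-WF h ls wf

  relabelAll-label-∉ : ∀ h ls e {u} → label e u ∉ ls → label (relabelAll h ls e) u ≡ label e u
  relabelAll-label-∉ h []       e ∉ls = refl
  relabelAll-label-∉ h (l ∷ ls) e {u} ∉ls =
    trans (ρ-label-≢ (relabelAll h ls e) (λ ≡l → ∉ls (here (trans (≡.sym unchanged) ≡l)))) unchanged
    where
    unchanged : label (relabelAll h ls e) u ≡ label e u
    unchanged = relabelAll-label-∉ h ls e (∉ls ∘ there)

  ρ-label-image : ∀ {h : Fin m → Fin m} → IdempotentFun _≡_ h → ∀ l (e : CwExpr n m) {u x} →
                  label e u ≡ h x → label (ρ l (h l) e) u ≡ h x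
  ρ-label-image {h} idem l e {u} {x} eq with label e u ≟ l
  ... | yes ≡l = trans (cong h (trans (≡.sym ≡l) eq)) (idem x)
  ... | no _   = eq

  -- Idempotence makes the order of the renamings irrelevant: a label once moved to h l is never moved again.
  relabelAll-label : ∀ {h : Fin m → Fin m} → IdempotentFun _≡_ h → ∀ ls (e : CwExpr n m) {u} → label e u ∈ ls →
                     label (relabelAll h ls e) u ≡ h (label e u)
  relabelAll-label {h} idem (l ∷ ls) e {u} ∈ls with label e u ∈? ls | ∈ls
  ... | yes ∈ls′ | _          = ρ-label-image idem l (relabelAll h ls e) {u} (relabelAll-label idem ls e ∈ls′)
  ... | no _     | there ∈ls′ = ρ-label-image idem l (relabelAll h ls e) {u} (relabelAll-label idem ls e ∈ls′)
  ... | no ∉ls′ | here ≡l    =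
    trans (ρ-label-≡ {j = h l} (relabelAll h ls e) {u} (trans (relabelAll-label-∉ h ls e ∉ls′) ≡l)) (cong h (≡.sym ≡l))

-- An idempotent map on labels merging the lab-classes on done into the coarser classes of f:
-- a used label goes to the label of a canonical member of its f-class.
module Coarsening {V B M : Set} (_≟ᴮ_ : DecidableEquality B) (_≟ᴹ_ : DecidableEquality M)
                  (f : V → B) (lab : V → M) (done : List V)
                  (lab⇒f : ∀ {u v} → u ∈ done → v ∈ done → lab u ≡ lab v → f u ≡ f v) where

  representative : B → Maybe V
  representative b = List.find (λ v → f v ≟ᴮ b) done

  canonical : V → V
  canonical u = fromMaybe u (representative (f u))

  representative-complete : ∀ {u} → u ∈ done → ∃[ c ] representative (f u) ≡ just c
  representative-complete u∈ = find-complete (λ v → f v ≟ᴮ _) (lose u∈ refl)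

  canonical-spec : ∀ {u} → u ∈ done → canonical u ∈ done × f (canonical u) ≡ f u
  canonical-spec {u} u∈ with representative-complete u∈
  ... | c , eq rewrite eq = find-sound (λ v → f v ≟ᴮ f u) eq

  canonical-cong : ∀ {u v} → u ∈ done → f u ≡ f v → canonical u ≡ canonical v
  canonical-cong {u} {v} u∈ fu≡fv with representative-complete u∈
  ... | c , eq =
    trans (cong (fromMaybe u) eq) (≡.sym (cong (fromMaybe v) (trans (cong representative (≡.sym fu≡fv)) eq)))

  coarsen : M → M
  coarsen l = maybe′ (lab ∘ canonical) l (List.find (λ u → lab u ≟ᴹ l) done)

  coarsen-lab : ∀ {u} → u ∈ done → coarsen (lab u) ≡ lab (canonical u)
  coarsen-lab {u} u∈ with find-complete (λ x → lab x ≟ᴹ lab u) (lose u∈ refl)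
  ... | h , eq rewrite eq = let h∈ , lh≡lu = find-sound (λ x → lab x ≟ᴹ lab u) eq
                            in cong lab (canonical-cong h∈ (lab⇒f h∈ u∈ lh≡lu))

  coarsen-unused : ∀ {l} → (∀ {u} → u ∈ done → lab u ≢ l) → coarsen l ≡ l
  coarsen-unused {l} unused rewrite find-none (λ x → lab x ≟ᴹ l) (All.tabulate unused) = refl

  coarsen-idempotent : IdempotentFun _≡_ coarsen
  coarsen-idempotent l with List.find (λ u → lab u ≟ᴹ l) done in eq
  ... | nothing = cong (maybe′ (lab ∘ canonical) l) eq
  ... | just h  = let h∈ , _     = find-sound (λ x → lab x ≟ᴹ l) eq
                      c∈ , fc≡fh = canonical-spec h∈
                  in trans (coarsen-lab c∈) (cong lab (canonical-cong c∈ fc≡fh))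

  coarsen-lab⇒f : ∀ {u v} → u ∈ done → v ∈ done → coarsen (lab u) ≡ coarsen (lab v) → f u ≡ f v
  coarsen-lab⇒f {u} {v} u∈ v∈ eq = begin
    f u             ≡⟨ proj₂ (canonical-spec u∈) ⟨
    f (canonical u) ≡⟨ lab⇒f (proj₁ (canonical-spec u∈)) (proj₁ (canonical-spec v∈)) labels≡ ⟩
    f (canonical v) ≡⟨ proj₂ (canonical-spec v∈) ⟩
    f v             ∎
    where
    open ≡.≡-Reasoning
    labels≡ : lab (canonical u) ≡ lab (canonical v)
    labels≡ = trans (≡.sym (coarsen-lab u∈)) (trans eq (coarsen-lab v∈))

  f⇒coarsen-lab : ∀ {u v} → u ∈ done → v ∈ done → f u ≡ f v → coarsen (lab u) ≡ coarsen (lab v)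
  f⇒coarsen-lab u∈ v∈ eq =
    trans (coarsen-lab u∈) (trans (cong lab (canonical-cong u∈ eq)) (≡.sym (coarsen-lab v∈)))

-- If every label of Fin L were used, a and one holder of each would be L + 1 vertices with distinct t.
unusedLabel : ∀ {V : Set} {L} (done : List V) (lab : V → Fin (suc L)) (t : V → Fin L) (a : V) →
              (∀ {u v} → u ∈ done → v ∈ done → t u ≡ t v → lab u ≡ lab v) →
              (∀ {u} → u ∈ done → t u ≢ t a) →
              ∃[ ℓ ] (∀ {u} → u ∈ done → lab u ≢ Fin.inject₁ ℓ)
unusedLabel {L = L} done lab t a t⇒lab a-new =
  Product.map₂ (λ unused u∈ eq → unused (lose u∈ eq))
               (¬∀⟶∃¬ L Used (λ ℓ → Any.any? (λ u → lab u ≟ Fin.inject₁ ℓ) done) allUsed⇒⊥)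
  where
  Used : Fin L → Set
  Used ℓ = Any (λ u → lab u ≡ Fin.inject₁ ℓ) done
  allUsed⇒⊥ : ¬ (∀ ℓ → Used ℓ)
  allUsed⇒⊥ used = collision (pigeonhole (n<1+n L) classOf)
    where
    user : ∀ ℓ → ∃[ u ] (u ∈ done × lab u ≡ Fin.inject₁ ℓ)
    user ℓ = Membership.find (used ℓ)
    classOf : Fin (suc L) → Fin L
    classOf Fin.zero    = t a
    classOf (Fin.suc ℓ) = t (proj₁ (user ℓ))
    collision : ¬ ∃₂ λ i j → i Fin.< j × classOf i ≡ classOf j
    collision (Fin.zero  , Fin.zero   , () , _)
    collision (Fin.suc _ , Fin.zero   , () , _)
    collision (Fin.zero  , Fin.suc ℓ  , _  , eq) = a-new (proj₁ (proj₂ (user ℓ))) (≡.sym eq)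
    collision (Fin.suc ℓ , Fin.suc ℓ′ , lt , eq) =
      let _ , u∈ , lu≡ℓ = user ℓ
          _ , u′∈ , lu′≡ℓ′ = user ℓ′
      in <-irrefl (cong Fin.suc (inject₁-injective (trans (≡.sym lu≡ℓ) (trans (t⇒lab u∈ u′∈ eq) lu′≡ℓ′)))) lt

module LinearConstruction (G : Graph) (E? : ∀ u v → Dec (E G u v)) (L : ℕ) where

  V : Set
  V = Fin (n G)

  spare : Fin (suc L)
  spare = Fin.fromℕ L

  adjacencies : List V → V → List Bool
  adjacencies rest u = List.map (λ y → ⌊ E? u y ⌋) rest

  record Stage (done rest : List V) (e : CwExpr (n G) (suc L)) : Set where
    field
      wf           : WF e
      inV⇒done     : ∀ {u} → inV e u ≡ true → u ∈ done
      done⇒inV     : ∀ {u} → u ∈ done → inV e u ≡ true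
      sound        : ∀ {u v} → edge e u v → E G u v
      complete     : ∀ {u v} → u ∈ done → v ∈ done → E G u v → edge e u v
      spare-unused : ∀ {u} → u ∈ done → label e u ≢ spare
      twins        : ∀ {u v} → u ∈ done → v ∈ done → label e u ≡ label e v →
                     adjacencies rest u ≡ adjacencies rest v

  singleStage : ∀ x rest {ℓ} → ℓ ≢ spare → Stage [ x ] rest (node x ℓ)
  singleStage x rest ℓ≢spare = record
    { wf           = tt
    ; inV⇒done     = λ {u} eq → here (isYes⇒ (u ≟ x) eq)
    ; done⇒inV     = λ { (here refl) → ⇒isYes (x ≟ x) refl }
    ; sound        = λ ()
    ; complete     = λ { (here refl) (here refl) exx → contradiction exx (irrefl G) }
    ; spare-unused = λ { (here refl) → ℓ≢spare }
    ; twins        = λ { (here refl) (here refl) _ → refl }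
    }

  module Step {done a rest e} (S : Stage done (a ∷ rest) e) (a∉ : a ∉ done) (t : V → Fin L)
              (t-twins : ∀ {u v} → u ∈ done ++ [ a ] → v ∈ done ++ [ a ] → t u ≡ t v →
                         adjacencies rest u ≡ adjacencies rest v) where
    open Stage S

    e₁ : CwExpr (n G) (suc L)
    e₁ = e ⊕ node a spare

    neighbourLabels : List (Fin (suc L))
    neighbourLabels = List.map (label e) (filter (λ u → E? u a) done)

    e₂ : CwExpr (n G) (suc L)
    e₂ = joinAll spare neighbourLabels e₁

    twins-rest : ∀ {u v} → u ∈ done → v ∈ done → label e u ≡ label e v →
                 adjacencies rest u ≡ adjacencies rest v
    twins-rest u∈ v∈ eq = ∷-injectiveʳ (twins u∈ v∈ eq)

    open Coarsening (≡-dec Bool._≟_) _≟_ (adjacencies rest) (label e) done twins-rest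

    e₃ : CwExpr (n G) (suc L)
    e₃ = relabelAll coarsen (allFin (suc L)) e₂

    coarsen-≢spare : ∀ {u} → u ∈ done → coarsen (label e u) ≢ spare
    coarsen-≢spare u∈ eq = spare-unused (proj₁ (canonical-spec u∈)) (trans (≡.sym (coarsen-lab u∈)) eq)

    a∈ : a ∈ done ++ [ a ]
    a∈ = ∈-++⁺ʳ done (here refl)

    -- The new label of a: the merged label of a twin of a, or else a label left free by the merging.
    target : ∃[ τ ] (τ ≢ spare ×
                     ∀ {u} → u ∈ done → coarsen (label e u) ≡ τ → adjacencies rest u ≡ adjacencies rest a)
    target with Any.any? (λ u → ≡-dec Bool._≟_ (adjacencies rest u) (adjacencies rest a)) done
    ... | yes twin = let u₀ , u₀∈ , u₀≈a = Membership.find twin in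
                     coarsen (label e u₀) , coarsen-≢spare u₀∈ ,
                     λ u∈ eq → trans (coarsen-lab⇒f u∈ u₀∈ eq) u₀≈a
    ... | no ¬twin = let ℓ , unused = unusedLabel done (coarsen ∘ label e) t a t⇒coarsen a-new in
                     Fin.inject₁ ℓ , fromℕ≢inject₁ ∘ ≡.sym , λ u∈ eq → contradiction eq (unused u∈)
      where
      t⇒coarsen : ∀ {u v} → u ∈ done → v ∈ done → t u ≡ t v → coarsen (label e u) ≡ coarsen (label e v)
      t⇒coarsen u∈ v∈ eq = f⇒coarsen-lab u∈ v∈ (t-twins (∈-++⁺ˡ u∈) (∈-++⁺ˡ v∈) eq)
      a-new : ∀ {u} → u ∈ done → t u ≢ t a
      a-new u∈ eq = ¬twin (lose u∈ (t-twins (∈-++⁺ˡ u∈) a∈ eq))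

    τ : Fin (suc L)
    τ = proj₁ target

    τ≢spare : τ ≢ spare
    τ≢spare = proj₁ (proj₂ target)

    τ-twins : ∀ {u} → u ∈ done → coarsen (label e u) ≡ τ → adjacencies rest u ≡ adjacencies rest a
    τ-twins = proj₂ (proj₂ target)

    e₄ : CwExpr (n G) (suc L)
    e₄ = ρ spare τ e₃

    inV-a : inV e a ≡ false
    inV-a with inV e a in eq
    ... | true  = contradiction (inV⇒done eq) a∉
    ... | false = refl

    inV₁⇒ : ∀ {u} → inV e₁ u ≡ true → u ∈ done ⊎ u ≡ a
    inV₁⇒ {u} eq with inV e u in eu
    ... | true  = inj₁ (inV⇒done eu)
    ... | false = inj₂ (isYes⇒ (u ≟ a) eq)

    label₁-done : ∀ {u} → u ∈ done → label e₁ u ≡ label e u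
    label₁-done u∈ rewrite done⇒inV u∈ = refl

    label₁-a : label e₁ a ≡ spare
    label₁-a rewrite inV-a = refl

    label₃ : ∀ u → label e₃ u ≡ coarsen (label e₁ u)
    label₃ u = trans (relabelAll-label coarsen-idempotent (allFin (suc L)) e₂ (∈-allFin _))
                     (cong coarsen (joinAll-label spare neighbourLabels e₁ u))

    label₃-done : ∀ {u} → u ∈ done → label e₃ u ≡ coarsen (label e u)
    label₃-done {u} u∈ = trans (label₃ u) (cong coarsen (label₁-done u∈))

    label₄-done : ∀ {u} → u ∈ done → label e₄ u ≡ coarsen (label e u)
    label₄-done u∈ = trans (ρ-label-≢ e₃ (coarsen-≢spare u∈ ∘ trans (≡.sym (label₃-done u∈)))) (label₃-done u∈)

    label₄-a : label e₄ a ≡ τ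
    label₄-a = ρ-label-≡ e₃ (trans (label₃ a) (trans (cong coarsen label₁-a) (coarsen-unused spare-unused)))

    lift₂ : ∀ {u v} → edge e₂ u v → edge e₄ u v
    lift₂ {u} {v} = subst (λ X → X) (≡.sym (relabelAll-edge coarsen (allFin (suc L)) e₂ u v))

    spare⇒a : ∀ {u} → inV e₁ u ≡ true → label e₁ u ≡ spare → u ≡ a
    spare⇒a iu lu with inV₁⇒ iu
    ... | inj₁ u∈ = contradiction (trans (≡.sym (label₁-done u∈)) lu) (spare-unused u∈)
    ... | inj₂ u≡a = u≡a

    nonspare⇒done : ∀ {v} → inV e₁ v ≡ true → label e₁ v ≢ spare → v ∈ done
    nonspare⇒done iv lv with inV₁⇒ iv
    ... | inj₁ v∈   = v∈
    ... | inj₂ refl = contradiction label₁-a lv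

    -- By `twins`, vertices with equal labels agree on adjacency to a.
    neighbourLabel⇒E : ∀ {v} → v ∈ done → label e v ∈ neighbourLabels → E G v a
    neighbourLabel⇒E {v} v∈ l∈ with ∈-map⁻ (label e) l∈
    ... | x , x∈ , lv≡lx with ∈-filter⁻ (λ u → E? u a) x∈
    ...   | x∈done , exa =
      isYes⇒ (E? v a) (trans (∷-injectiveˡ (twins v∈ x∈done lv≡lx)) (⇒isYes (E? x a) exa))

    joined⇒E : ∀ {u v l} → inV e₁ u ≡ true → inV e₁ v ≡ true → l ∈ neighbourLabels → l ≢ spare →
               label e₁ u ≡ spare → label e₁ v ≡ l → E G u v
    joined⇒E {v = v} {l} iu iv l∈ l≢s lu lv with spare⇒a iu lu
    ... | refl = Graph.sym G (neighbourLabel⇒E v∈ (subst (_∈ neighbourLabels) (≡.sym lv′) l∈))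
      where
      v∈ : v ∈ done
      v∈ = nonspare⇒done iv (λ eq → l≢s (trans (≡.sym lv) eq))
      lv′ : label e v ≡ l
      lv′ = trans (≡.sym (label₁-done v∈)) lv

    sound′ : ∀ {u v} → edge e₄ u v → E G u v
    sound′ {u} {v} uv
      with joinAll-edge⁻ spare neighbourLabels e₁ (subst (λ X → X) (relabelAll-edge coarsen (allFin (suc L)) e₂ u v) uv)
    ... | inj₁ (inj₁ uv′) = sound uv′
    ... | inj₂ (iu , iv , l , l∈ , l≢s , inj₁ (lu , lv)) = joined⇒E iu iv l∈ l≢s lu lv
    ... | inj₂ (iu , iv , l , l∈ , l≢s , inj₂ (lu , lv)) = Graph.sym G (joined⇒E iv iu l∈ l≢s lv lu)

    inV₁-done : ∀ {u} → u ∈ done → inV e₁ u ≡ true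
    inV₁-done u∈ rewrite done⇒inV u∈ = refl

    inV₁-a : inV e₁ a ≡ true
    inV₁-a = trans (cong (inV e a ∨_) (⇒isYes (a ≟ a) refl)) (∨-zeroʳ _)

    joined-a : ∀ {v} → v ∈ done → E G v a → Joined spare neighbourLabels e₁ a v
    joined-a {v} v∈ eva = inV₁-a , inV₁-done v∈ , label e v , ∈-map⁺ (label e) (∈-filter⁺ (λ u → E? u a) v∈ eva) ,
                          spare-unused v∈ , inj₁ (label₁-a , label₁-done v∈)

    complete′ : ∀ {u v} → u ∈ done ++ [ a ] → v ∈ done ++ [ a ] → E G u v → edge e₄ u v
    complete′ u∈ v∈ euv with ∈-snoc⁻ done u∈ | ∈-snoc⁻ done v∈
    ... | inj₁ u∈′  | inj₁ v∈′  = lift₂ (joinAll-edge⁺ˡ spare neighbourLabels e₁ (inj₁ (complete u∈′ v∈′ euv)))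
    ... | inj₂ refl | inj₁ v∈′  = lift₂ (joinAll-edge⁺ʳ spare neighbourLabels e₁ (joined-a v∈′ (Graph.sym G euv)))
    ... | inj₁ u∈′  | inj₂ refl = lift₂ (joinAll-edge⁺ʳ spare neighbourLabels e₁ (Joined-swap e₁ (joined-a u∈′ euv)))
    ... | inj₂ refl | inj₂ refl = contradiction euv (irrefl G)

    inV₄ : ∀ u → inV e₄ u ≡ inV e₁ u
    inV₄ u = trans (relabelAll-inV coarsen (allFin (suc L)) e₂ u) (joinAll-inV spare neighbourLabels e₁ u)

    wf₁ : WF e₁
    wf₁ = wf , tt , λ u iu → ⇒isNo (u ≟ a) (λ { refl → a∉ (inV⇒done iu) })

    stage : Stage (done ++ [ a ]) rest e₄
    stage = record
      { wf           = relabelAll-WF coarsen (allFin (suc L)) (joinAll-WF spare neighbourLabels wf₁)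
      ; inV⇒done     = λ {u} iu → [ ∈-++⁺ˡ , (λ { refl → a∈ }) ]′ (inV₁⇒ (trans (≡.sym (inV₄ u)) iu))
      ; done⇒inV     = λ {u} u∈ → trans (inV₄ u) ([ inV₁-done , (λ { refl → inV₁-a }) ]′ (∈-snoc⁻ done u∈))
      ; sound        = sound′
      ; complete     = complete′
      ; spare-unused = spare-unused′
      ; twins        = twins′
      }
      where
      spare-unused′ : ∀ {u} → u ∈ done ++ [ a ] → label e₄ u ≢ spare
      spare-unused′ u∈ with ∈-snoc⁻ done u∈
      ... | inj₁ u∈′ = λ eq → coarsen-≢spare u∈′ (trans (≡.sym (label₄-done u∈′)) eq)
      ... | inj₂ refl = λ eq → τ≢spare (trans (≡.sym label₄-a) eq)
      twins′ : ∀ {u v} → u ∈ done ++ [ a ] → v ∈ done ++ [ a ] → label e₄ u ≡ label e₄ v →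
               adjacencies rest u ≡ adjacencies rest v
      twins′ u∈ v∈ eq with ∈-snoc⁻ done u∈ | ∈-snoc⁻ done v∈
      ... | inj₁ u∈′  | inj₁ v∈′  =
        coarsen-lab⇒f u∈′ v∈′ (trans (≡.sym (label₄-done u∈′)) (trans eq (label₄-done v∈′)))
      ... | inj₁ u∈′  | inj₂ refl = τ-twins u∈′ (trans (≡.sym (label₄-done u∈′)) (trans eq label₄-a))
      ... | inj₂ refl | inj₁ v∈′  =
        ≡.sym (τ-twins v∈′ (trans (≡.sym (label₄-done v∈′)) (trans (≡.sym eq) label₄-a)))
      ... | inj₂ refl | inj₂ refl = refl

  sameNeighbours⇒adjacencies≡ : ∀ {R u v} → SameNeighbours G R u v → adjacencies R u ≡ adjacencies R v
  sameNeighbours⇒adjacencies≡ {[]}    same = refl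
  sameNeighbours⇒adjacencies≡ {y ∷ R} {u} {v} same =
    cong₂ _∷_ (isYes-⇔ (same (here refl)) (E? u y) (E? v y)) (sameNeighbours⇒adjacencies≡ (same ∘ there))

  module Build (σ : List V) (σ-unique : Unique σ)
               (classes : ∀ pre rest → σ ≡ pre ++ rest → NeighbourClasses≤ L G pre rest) where

    build : ∀ rest {pre e} → σ ≡ pre ++ rest → Stage pre rest e → ∃[ e′ ] Stage σ [] e′
    build []         {pre} {e} σ≡ S = e , subst (λ d → Stage d [] e) (≡.sym (trans σ≡ (++-identityʳ pre))) S
    build (a ∷ rest) {pre}     σ≡ S =
      let t , t-classes = classes (pre ++ [ a ]) rest σ≡′
      in build rest σ≡′ (Step.stage S a∉ t (λ u∈ v∈ eq → sameNeighbours⇒adjacencies≡ (t-classes u∈ v∈ eq)))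
      where
      σ≡′ : σ ≡ (pre ++ [ a ]) ++ rest
      σ≡′ = trans σ≡ (≡.sym (++-assoc pre [ a ] rest))
      a∉ : a ∉ pre
      a∉ = Unique-++-disjoint pre (subst Unique σ≡ σ-unique) (here refl)

    buildFrom : ∀ x rest → σ ≡ x ∷ rest → ∃[ e ] Stage σ [] e
    buildFrom x rest σ≡ =
      build rest σ≡ (singleStage x rest {Fin.inject₁ (proj₁ (classes [ x ] rest σ≡) x)}
                                 (fromℕ≢inject₁ ∘ ≡.sym))

noVertices⇒0 : ∀ {N} → (Fin N → ⊥) → N ≡ 0
noVertices⇒0 {zero}  _     = refl
noVertices⇒0 {suc _} ¬fin = contradiction Fin.zero ¬fin

neighbourClasses⇒CwdLe : ∀ (G : Graph) L → (∀ u v → Dec (E G u v)) → (σ : List (Fin (n G))) → Unique σ →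
                         (∀ u → u ∈ σ) → (∀ pre rest → σ ≡ pre ++ rest → NeighbourClasses≤ L G pre rest) →
                         CwdLe G (suc L)
neighbourClasses⇒CwdLe G L E? []      _        covers _       = inj₁ (noVertices⇒0 (λ u → ¬Any[] (covers u)))
neighbourClasses⇒CwdLe G L E? (x ∷ σ) σ-unique covers classes =
  inj₂ (proj₁ built , wf , (λ u → done⇒inV (covers u)) , λ u v → mk⇔ sound (complete (covers u) (covers v)))
  where
  open LinearConstruction G E? L
  open Build (x ∷ σ) σ-unique classes
  built : ∃[ e ] Stage (x ∷ σ) [] e
  built = buildFrom x σ refl
  open Stage (proj₂ built)

mainTheorem7 : (k : ℕ) (G : Graph) → InL k G → CwdLe G (2 ^ k + 1)
mainTheorem7 k G (w , represents , σ , (σ-unique , σ⇔w) , local) =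
  subst (CwdLe G) (+-comm 1 (2 ^ k))
        (neighbourClasses⇒CwdLe G (2 ^ k) (Represents⇒E? {G} represents) σ σ-unique
                                 (λ u → Equivalence.from (σ⇔w u) (proj₁ represents u))
                                 (marking⇒NeighbourClasses≤ {G = G} represents σ-unique local))
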